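{- Assume that for every integer $e\ge 1$ and every integer $k$ with $0\le k<2^{e-1}$, $$\nu\bigl(f(2^e+2k+1)-f(2k+1)\bigr)\ge e-2\lg(k+3)+2\nu(k+1).$$ Suppose $x=\sum_{i\ge1}2^{e_i}\in\mathbb{Z}_2$ with $e_1=0$, $e_i<e_{i+1}$ for all $i$, and $\lim_{i\to\infty}(e_{i+1}-2e_i)=\infty$. Then $f(x)$ is 2-definable.
   Context: For $n\in\mathbb{N}$ (natural numbers including $0$), $f(n)=\sum_{k=0}^n\binom nk^{ -1}\in\mathbb{Q}\subset\mathbb{Q}_2$. $\nu(-)$ denotes the exponent of $2$ in a rational number (2-adic valuation, $\nu(0)=\infty$). $\lg(y)=\lfloor\log_2 y\rfloor$. For $x\in\mathbb{Z}_2$ with $x_j$ its mod $2^j$ reduction (an integer in $[0,2^j)$), $f(x)$ is called 2-definable if the sequence $\langle f(x_j)\rangle$ is a Cauchy sequence in $\mathbb{Q}_2$ (with the 2-adic metric $d(x,y)=2^{ -\nu(x-y)}$). -}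

module Defs where

open import Data.Nat as ℕ using (ℕ; zero; suc; _+_; _*_; _^_; _<_; _≤_; _<ᵇ_)
open import Data.Nat.Combinatorics using (_C_)
open import Data.Nat.DivMod using (_/_; _%_)
open import Data.Nat.Logarithm using (⌊log₂_⌋)
open import Data.Integer as ℤ using (ℤ; +_; -[1+_])
open import Data.Rational as ℚ using (ℚ)
open import Data.Bool using (if_then_else_)
open import Data.Product using (∃; Σ)
open import Relation.Binary.PropositionalEquality using (_≡_)

sumℚ : ℕ → (ℕ → ℚ) → ℚ
sumℚ zero    g = ℚ.0ℚ
sumℚ (suc n) g = sumℚ n g ℚ.+ g n

sumℕ : ℕ → (ℕ → ℕ) → ℕ
sumℕ zero    g = 0
sumℕ (suc n) g = sumℕ n g + g n

-- reciprocal of a natural number (only applied to positive numbers below)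
recip : ℕ → ℚ
recip zero    = ℚ.0ℚ
recip (suc m) = (+ 1) ℚ./ suc m

-- f(n) = Σ_{k=0}^{n} (n choose k)^{-1}   (n choose k ≥ 1 for k ≤ n)
f : ℕ → ℚ
f n = sumℚ (suc n) (λ k → recip (n C k))

-- 2-adic valuation of a positive natural number (ν 0 = 0 is a dummy value)
νgo : ℕ → ℕ → ℕ
νgo zero     n = 0
νgo (suc fu) zero = 0
νgo (suc fu) (suc n) = if (suc n % 2) ℕ.≡ᵇ 0 then suc (νgo fu (suc n / 2)) else 0

νℕ : ℕ → ℕ
νℕ n = νgo n n

lg : ℕ → ℕ
lg = ⌊log₂_⌋

pow2 : ℤ → ℚ
pow2 (+ n)     = (+ (2 ^ n)) ℚ./ 1
pow2 -[1+ n ]  = recip (2 ^ suc n)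

-- ν(q) ≥ m  (for q ∈ ℚ, m ∈ ℤ):  q = (a / odd) · 2^m for some a ∈ ℤ and odd
-- natural number 2c+1.  (q = 0 satisfies this for every m, matching ν(0) = ∞.)
ν≥ : ℚ → ℤ → Set
ν≥ q m = ∃ λ (a : ℤ) → ∃ λ (c : ℕ) → q ≡ (a ℚ./ suc (2 * c)) ℚ.* pow2 m

-- the 2-adic integer x = Σ_{i≥0} 2^{e i} (paper's e_{i+1} = our e i),
-- for e strictly increasing; its reduction mod 2^j is the sum of the
-- terms 2^{e i} with e i < j (all such i satisfy i < j since e i ≥ i).
xmod : (ℕ → ℕ) → ℕ → ℕ
xmod e j = sumℕ j (λ i → if e i <ᵇ j then 2 ^ e i else 0)

-- f(x) is 2-definable: ⟨ f(x_j) ⟩ is Cauchy in ℚ₂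
TwoDefinable : (ℕ → ℕ) → Set
TwoDefinable x = ∀ (M : ℕ) → ∃ λ (N : ℕ) → ∀ (j j′ : ℕ) → N ≤ j → N ≤ j′ →
  ν≥ (f (x j) ℚ.- f (x j′)) (+ M)

module Submission where

-- Write S i = 2^{e 0} + … + 2^{e i} for the partial sums of
-- x = Σ 2^{e i}.  Every reduction x_j with j > e 0 equals some S i (namely
-- the one with e i < j ≤ e (i+1)), so it suffices to show that the sequence
-- f (S i) is 2-adically Cauchy.  Since e 0 = 0, S i = 2 K i + 1 with
-- K i < 2^{e i}, and S (i+1) = 2^{e (i+1)} + 2 K i + 1; the hypothesis of the
-- theorem (with e := e (i+1), k := K i) bounds ν(f (S (i+1)) - f (S i)) from
-- below by e (i+1) - 2 lg (K i + 3) ≥ e (i+1) - 2 e i - 4, which tends to ∞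
-- by the growth condition.  In the ultrametric ℚ₂ small consecutive
-- differences already give small pairwise differences.

open import Defs
open import Data.Nat using (ℕ; zero; suc; _+_; _*_; _^_; _∸_; _<_; _≤_)
open import Data.Integer using (+_; _-_) renaming (_+_ to _+ℤ_)
open import Data.Rational using () renaming (_-_ to _-ℚ_)
open import Data.Product using (∃)
open import Relation.Binary.PropositionalEquality using (_≡_)

open import Data.Nat using (z≤n; s≤s; s≤s⁻¹; pred; _<ᵇ_)
import Data.Nat.Properties as ℕₚ
open import Data.Nat.Logarithm using (⌊log₂⌋-mono-≤; ⌊log₂[2^n]⌋≡n)
import Data.Nat.Solver as ℕSolver
import Data.Integer as ℤ
import Data.Integer.Properties as ℤₚ
import Data.Rational as ℚ
import Data.Rational.Properties as ℚₚ
import Data.Rational.Unnormalised as ℚᵘ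
import Data.Rational.Unnormalised.Properties as ℚᵘₚ
import Data.Rational.Solver as ℚSolver
open import Data.Bool using (true; false; T; if_then_else_)
open import Data.Unit using (tt)
open import Data.Empty using (⊥-elim)
open import Data.Product using (_,_; _×_)
open import Data.Sum using (inj₁; inj₂)
open import Relation.Nullary using (¬_)
open import Relation.Binary.PropositionalEquality
  using (refl; sym; trans; cong; cong₂; subst; module ≡-Reasoning)

fromℚᵘ-+ : ∀ x y → ℚ.fromℚᵘ x ℚ.+ ℚ.fromℚᵘ y ≡ ℚ.fromℚᵘ (x ℚᵘ.+ y)
fromℚᵘ-+ x y = trans (sym (ℚₚ.fromℚᵘ-toℚᵘ (ℚ.fromℚᵘ x ℚ.+ ℚ.fromℚᵘ y))) (ℚₚ.fromℚᵘ-cong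
  (ℚᵘₚ.≃-trans (ℚₚ.toℚᵘ-homo-+ (ℚ.fromℚᵘ x) (ℚ.fromℚᵘ y)) (ℚᵘₚ.+-cong (ℚₚ.toℚᵘ-fromℚᵘ x) (ℚₚ.toℚᵘ-fromℚᵘ y))))

fromℚᵘ-* : ∀ x y → ℚ.fromℚᵘ x ℚ.* ℚ.fromℚᵘ y ≡ ℚ.fromℚᵘ (x ℚᵘ.* y)
fromℚᵘ-* x y = trans (sym (ℚₚ.fromℚᵘ-toℚᵘ (ℚ.fromℚᵘ x ℚ.* ℚ.fromℚᵘ y))) (ℚₚ.fromℚᵘ-cong
  (ℚᵘₚ.≃-trans (ℚₚ.toℚᵘ-homo-* (ℚ.fromℚᵘ x) (ℚ.fromℚᵘ y)) (ℚᵘₚ.*-cong (ℚₚ.toℚᵘ-fromℚᵘ x) (ℚₚ.toℚᵘ-fromℚᵘ y))))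

fromℚᵘ-neg : ∀ x → ℚ.- ℚ.fromℚᵘ x ≡ ℚ.fromℚᵘ (ℚᵘ.- x)
fromℚᵘ-neg x = trans (sym (ℚₚ.fromℚᵘ-toℚᵘ (ℚ.- ℚ.fromℚᵘ x))) (ℚₚ.fromℚᵘ-cong
  (ℚᵘₚ.≃-trans (ℚₚ.toℚᵘ-homo‿- (ℚ.fromℚᵘ x)) (ℚᵘₚ.-‿cong (ℚₚ.toℚᵘ-fromℚᵘ x))))

ν≥-0 : ∀ m → ν≥ ℚ.0ℚ m
ν≥-0 m = ℤ.0ℤ , 0 , sym (ℚₚ.*-zeroˡ (pow2 m))

ν≥-neg : ∀ q m → ν≥ q m → ν≥ (ℚ.- q) m
ν≥-neg q m (a , c , q≡) = ℤ.- a , c , (begin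
  ℚ.- q                                        ≡⟨ cong ℚ.-_ q≡ ⟩
  ℚ.- (ℚ.fromℚᵘ A ℚ.* pow2 m)                  ≡⟨ ℚₚ.neg-distribˡ-* (ℚ.fromℚᵘ A) (pow2 m) ⟩
  ℚ.- ℚ.fromℚᵘ A ℚ.* pow2 m                    ≡⟨ cong (ℚ._* pow2 m) (fromℚᵘ-neg A) ⟩
  ℚ.fromℚᵘ (ℚᵘ.mkℚᵘ (ℤ.- a) (2 * c)) ℚ.* pow2 m ∎)
  where
  open ≡-Reasoning
  A = ℚᵘ.mkℚᵘ a (2 * c)

odd-product : ∀ c d → pred (suc (2 * c) * suc (2 * d)) ≡ 2 * (d + c * suc (2 * d))
odd-product c d = solve 2 (λ c d → con 2 :* d :+ con 2 :* c :* (con 1 :+ con 2 :* d)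
                                  := con 2 :* (d :+ c :* (con 1 :+ con 2 :* d))) refl c d
  where open ℕSolver.+-*-Solver

ν≥-+ : ∀ p q m → ν≥ p m → ν≥ q m → ν≥ (p ℚ.+ q) m
ν≥-+ p q m (a , c , p≡) (b , d , q≡) = numerator , d + c * suc (2 * d) , (begin
  p ℚ.+ q                                  ≡⟨ cong₂ ℚ._+_ p≡ q≡ ⟩
  ℚ.fromℚᵘ A ℚ.* pow2 m ℚ.+ ℚ.fromℚᵘ B ℚ.* pow2 m ≡⟨ sym (ℚₚ.*-distribʳ-+ (pow2 m) (ℚ.fromℚᵘ A) (ℚ.fromℚᵘ B)) ⟩
  (ℚ.fromℚᵘ A ℚ.+ ℚ.fromℚᵘ B) ℚ.* pow2 m   ≡⟨ cong (ℚ._* pow2 m) (fromℚᵘ-+ A B) ⟩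
  ℚ.fromℚᵘ (A ℚᵘ.+ B) ℚ.* pow2 m            ≡⟨ cong (λ n → ℚ.fromℚᵘ (ℚᵘ.mkℚᵘ numerator n) ℚ.* pow2 m) (odd-product c d) ⟩
  _ ∎)
  where
  open ≡-Reasoning
  A = ℚᵘ.mkℚᵘ a (2 * c)
  B = ℚᵘ.mkℚᵘ b (2 * d)
  numerator = a ℤ.* + suc (2 * d) ℤ.+ b ℤ.* + suc (2 * c)

ν≥-weaken : ∀ q M d → ν≥ q (+ (M + d)) → ν≥ q (+ M)
ν≥-weaken q M d (a , c , q≡) = a ℤ.* + (2 ^ d) , c , (begin
  q                                       ≡⟨ q≡ ⟩
  ℚ.fromℚᵘ A ℚ.* pow2 (+ (M + d))         ≡⟨ fromℚᵘ-* A (ℚᵘ.mkℚᵘ (+ (2 ^ (M + d))) 0) ⟩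
  ℚ.fromℚᵘ (ℚᵘ.mkℚᵘ (a ℤ.* + (2 ^ (M + d))) _) ≡⟨ cong (λ z → ℚ.fromℚᵘ (ℚᵘ.mkℚᵘ z _)) numerator ⟩
  ℚ.fromℚᵘ (ℚᵘ.mkℚᵘ (a ℤ.* + (2 ^ d) ℤ.* + (2 ^ M)) _) ≡⟨ sym (fromℚᵘ-* (ℚᵘ.mkℚᵘ (a ℤ.* + (2 ^ d)) (2 * c)) _) ⟩
  ℚ.fromℚᵘ (ℚᵘ.mkℚᵘ (a ℤ.* + (2 ^ d)) (2 * c)) ℚ.* pow2 (+ M) ∎)
  where
  open ≡-Reasoning
  A = ℚᵘ.mkℚᵘ a (2 * c)
  numerator : a ℤ.* + (2 ^ (M + d)) ≡ a ℤ.* + (2 ^ d) ℤ.* + (2 ^ M)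
  numerator = begin
    a ℤ.* + (2 ^ (M + d))         ≡⟨ cong (λ z → a ℤ.* + z) (trans (ℕₚ.^-distribˡ-+-* 2 M d) (ℕₚ.*-comm (2 ^ M) (2 ^ d))) ⟩
    a ℤ.* + (2 ^ d * 2 ^ M)       ≡⟨ cong (a ℤ.*_) (ℤₚ.pos-* (2 ^ d) (2 ^ M)) ⟩
    a ℤ.* (+ (2 ^ d) ℤ.* + (2 ^ M)) ≡⟨ sym (ℤₚ.*-assoc a _ _) ⟩
    a ℤ.* + (2 ^ d) ℤ.* + (2 ^ M) ∎

ν≥-from-bound : ∀ q M E L v → M + L ≤ E → ν≥ q ((+ E - + L) +ℤ + v) → ν≥ q (+ M)
ν≥-from-bound q M E L v M+L≤E ν≥q = ν≥-weaken q M (E ∸ L ∸ M + v) (subst (ν≥ q) exponent ν≥q)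
  where
  open ≡-Reasoning
  L≤E : L ≤ E
  L≤E = ℕₚ.≤-trans (ℕₚ.m≤n+m L M) M+L≤E
  M≤E∸L : M ≤ E ∸ L
  M≤E∸L = subst (_≤ E ∸ L) (ℕₚ.m+n∸n≡m M L) (ℕₚ.∸-monoˡ-≤ L M+L≤E)
  exponent : (+ E - + L) +ℤ + v ≡ + (M + (E ∸ L ∸ M + v))
  exponent = begin
    (+ E - + L) +ℤ + v       ≡⟨ cong (_+ℤ + v) (trans (ℤₚ.m-n≡m⊖n E L) (ℤₚ.⊖-≥ L≤E)) ⟩
    + (E ∸ L) +ℤ + v         ≡⟨ sym (ℤₚ.pos-+ (E ∸ L) v) ⟩
    + (E ∸ L + v)            ≡⟨ cong (λ z → + (z + v)) (sym (ℕₚ.m+[n∸m]≡n M≤E∸L)) ⟩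
    + (M + (E ∸ L ∸ M) + v)  ≡⟨ cong +_ (ℕₚ.+-assoc M (E ∸ L ∸ M) v) ⟩
    + (M + (E ∸ L ∸ M + v))  ∎

module _ (T : ℕ → ℚ.ℚ) (M N : ℕ) (consecutive : ∀ i → N ≤ i → ν≥ (T (suc i) -ℚ T i) (+ M)) where

  private
    telescope : ∀ a b c → b -ℚ a ≡ (b -ℚ c) ℚ.+ (c -ℚ a)
    telescope = solve 3 (λ a b c → b :- a := (b :- c) :+ (c :- a)) refl
      where open ℚSolver.+-*-Solver

    antisymmetry : ∀ a b → a -ℚ b ≡ ℚ.- (b -ℚ a)
    antisymmetry = solve 2 (λ a b → a :- b := :- (b :- a)) refl
      where open ℚSolver.+-*-Solver

    ν≥-forward : ∀ i t → N ≤ i → ν≥ (T (t + i) -ℚ T i) (+ M)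
    ν≥-forward i zero    _   = subst (λ q → ν≥ q (+ M)) (sym (ℚₚ.+-inverseʳ (T i))) (ν≥-0 (+ M))
    ν≥-forward i (suc t) N≤i = subst (λ q → ν≥ q (+ M)) (sym (telescope (T i) (T (suc t + i)) (T (t + i))))
      (ν≥-+ _ _ (+ M) (consecutive (t + i) (ℕₚ.≤-trans N≤i (ℕₚ.m≤n+m i t))) (ν≥-forward i t N≤i))

    ν≥-ordered : ∀ i i' → N ≤ i' → i' ≤ i → ν≥ (T i -ℚ T i') (+ M)
    ν≥-ordered i i' N≤i' i'≤i =
      subst (λ z → ν≥ (T z -ℚ T i') (+ M)) (ℕₚ.m∸n+n≡m i'≤i) (ν≥-forward i' (i ∸ i') N≤i')

  ultrametric-Cauchy : ∀ i i' → N ≤ i → N ≤ i' → ν≥ (T i -ℚ T i') (+ M)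
  ultrametric-Cauchy i i' N≤i N≤i' with ℕₚ.≤-total i' i
  ... | inj₁ i'≤i = ν≥-ordered i i' N≤i' i'≤i
  ... | inj₂ i≤i' = subst (λ q → ν≥ q (+ M)) (sym (antisymmetry (T i) (T i')))
                          (ν≥-neg _ (+ M) (ν≥-ordered i' i N≤i i≤i'))

sumℕ-cong : ∀ n (g h : ℕ → ℕ) → (∀ l → l < n → g l ≡ h l) → sumℕ n g ≡ sumℕ n h
sumℕ-cong zero    g h _     = refl
sumℕ-cong (suc n) g h g≡h = cong₂ _+_ (sumℕ-cong n g h (λ l l<n → g≡h l (ℕₚ.m<n⇒m<1+n l<n))) (g≡h n ℕₚ.≤-refl)

sumℕ-vanishing-tail : ∀ m n (g : ℕ → ℕ) → m ≤ n → (∀ l → m ≤ l → l < n → g l ≡ 0) → sumℕ n g ≡ sumℕ m g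
sumℕ-vanishing-tail m zero    g z≤n _ = refl
sumℕ-vanishing-tail m (suc n) g m≤1+n vanish with ℕₚ.m≤n⇒m<n∨m≡n m≤1+n
... | inj₂ refl = refl
... | inj₁ m<1+n = begin
  sumℕ n g + g n ≡⟨ cong₂ _+_ (sumℕ-vanishing-tail m n g m≤n (λ l m≤l l<n → vanish l m≤l (ℕₚ.m<n⇒m<1+n l<n)))
                             (vanish n m≤n ℕₚ.≤-refl) ⟩
  sumℕ m g + 0   ≡⟨ ℕₚ.+-identityʳ (sumℕ m g) ⟩
  sumℕ m g       ∎
  where
  open ≡-Reasoning
  m≤n = s≤s⁻¹ m<1+n

if-T : ∀ {A : Set} b {x y : A} → T b → (if b then x else y) ≡ x
if-T true _ = refl

if-¬T : ∀ {A : Set} b {x y : A} → ¬ T b → (if b then x else y) ≡ y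
if-¬T true  ¬t = ⊥-elim (¬t tt)
if-¬T false _  = refl

-- lg (k + 3) ≤ a + 2 whenever k < 2^a, since k + 3 ≤ 4 · 2^a.
lg-bound : ∀ k a → k < 2 ^ a → lg (k + 3) ≤ a + 2
lg-bound k a k<2^a = ℕₚ.≤-trans (⌊log₂⌋-mono-≤ k+3≤2^[a+2]) (ℕₚ.≤-reflexive (⌊log₂[2^n]⌋≡n (a + 2)))
  where
  open ℕₚ.≤-Reasoning
  P = 2 ^ a
  k+3≤2^[a+2] : k + 3 ≤ 2 ^ (a + 2)
  k+3≤2^[a+2] = begin
    k + 3         ≡⟨ ℕₚ.+-comm k 3 ⟩
    3 + k         ≤⟨ ℕₚ.+-monoʳ-≤ 2 k<2^a ⟩
    2 + P         ≤⟨ ℕₚ.+-monoˡ-≤ P (ℕₚ.*-monoʳ-≤ 2 (ℕₚ.m^n>0 2 a)) ⟩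
    2 * P + P     ≤⟨ ℕₚ.+-monoʳ-≤ (2 * P) (ℕₚ.m≤m+n P P) ⟩
    2 * P + (P + P) ≡⟨ solve 1 (λ p → con 2 :* p :+ (p :+ p) := p :* con 4) refl P ⟩
    P * 4         ≡⟨ sym (ℕₚ.^-distribˡ-+-* 2 a 2) ⟩
    2 ^ (a + 2)   ∎
    where open ℕSolver.+-*-Solver

double-half-power : ∀ E → 1 ≤ E → 2 * 2 ^ (E ∸ 1) ≡ 2 ^ E
double-half-power (suc E) _ = refl

module PartialSums (e : ℕ → ℕ) (increasing : ∀ i → e i < e (suc i)) where

  e-mono : ∀ a b → a ≤ b → e a ≤ e b
  e-mono a zero    z≤n   = ℕₚ.≤-refl
  e-mono a (suc b) a≤1+b with ℕₚ.m≤n⇒m<n∨m≡n a≤1+b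
  ... | inj₂ refl      = ℕₚ.≤-refl
  ... | inj₁ a<1+b     = ℕₚ.≤-trans (e-mono a b (s≤s⁻¹ a<1+b)) (ℕₚ.<⇒≤ (increasing b))

  index≤e : ∀ i → i ≤ e i
  index≤e zero    = z≤n
  index≤e (suc i) = ℕₚ.≤-<-trans (index≤e i) (increasing i)

  S : ℕ → ℕ
  S i = sumℕ (suc i) (λ l → 2 ^ e l)

  bracket : ∀ j → e 0 < j → ∃ λ i → e i < j × j ≤ e (suc i)
  bracket (suc j) e0<1+j with ℕₚ.m≤n⇒m<n∨m≡n (s≤s⁻¹ e0<1+j)
  ... | inj₂ refl = 0 , ℕₚ.≤-refl , increasing 0
  ... | inj₁ e0<j with bracket j e0<j
  ...   | i , ei<j , j≤ei+1 with ℕₚ.m≤n⇒m<n∨m≡n j≤ei+1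
  ...     | inj₁ j<ei+1 = i , ℕₚ.m<n⇒m<1+n ei<j , j<ei+1
  ...     | inj₂ refl   = suc i , ℕₚ.≤-refl , increasing (suc i)

  -- On such an interval the reduction x_j is the partial sum S i: exactly
  -- the exponents e 0, …, e i are below j.
  xmod-on-interval : ∀ i j → e i < j → j ≤ e (suc i) → xmod e j ≡ S i
  xmod-on-interval i j ei<j j≤ei+1 =
    trans (sumℕ-vanishing-tail (suc i) j digit (ℕₚ.≤-<-trans (index≤e i) ei<j) digit-above)
          (sumℕ-cong (suc i) digit (λ l → 2 ^ e l) digit-below)
    where
    digit : ℕ → ℕ
    digit l = if e l <ᵇ j then 2 ^ e l else 0
    digit-below : ∀ l → l < suc i → digit l ≡ 2 ^ e l
    digit-below l l<1+i = if-T (e l <ᵇ j) (ℕₚ.<⇒<ᵇ (ℕₚ.≤-<-trans (e-mono l i (s≤s⁻¹ l<1+i)) ei<j))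
    digit-above : ∀ l → suc i ≤ l → l < j → digit l ≡ 0
    digit-above l i<l _ = if-¬T (e l <ᵇ j)
      (λ el<ᵇj → ℕₚ.<⇒≱ (ℕₚ.<ᵇ⇒< (e l) j el<ᵇj) (ℕₚ.≤-trans j≤ei+1 (e-mono (suc i) l i<l)))

  xmod-late : ∀ N j → e N < j → ∃ λ i → N ≤ i × xmod e j ≡ S i
  xmod-late N j eN<j with bracket j (ℕₚ.≤-<-trans (e-mono 0 N z≤n) eN<j)
  ... | i , ei<j , j≤ei+1 = i , N≤i , xmod-on-interval i j ei<j j≤ei+1
    where
    N≤i : N ≤ i
    N≤i = ℕₚ.≮⇒≥ (λ i<N → ℕₚ.<⇒≱ eN<j (ℕₚ.≤-trans j≤ei+1 (e-mono (suc i) N i<N)))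

  -- Half of S i - 2^{e 0}; it is the k of the hypothesis.
  K : ℕ → ℕ
  K zero    = 0
  K (suc i) = K i + 2 ^ (e (suc i) ∸ 1)

  1≤e[1+i] : ∀ i → 1 ≤ e (suc i)
  1≤e[1+i] i = ℕₚ.≤-trans (s≤s z≤n) (increasing i)

  K-bound : ∀ i → K i < 2 ^ e i
  K-bound zero    = ℕₚ.m^n>0 2 (e 0)
  K-bound (suc i) = begin-strict
    K i + P       <⟨ ℕₚ.+-monoˡ-< P (K-bound i) ⟩
    2 ^ e i + P   ≤⟨ ℕₚ.+-monoˡ-≤ P (ℕₚ.^-monoʳ-≤ 2 (ℕₚ.<⇒≤pred (increasing i))) ⟩
    P + P         ≡⟨ cong (λ z → P + z) (sym (ℕₚ.+-identityʳ P)) ⟩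
    2 * P         ≡⟨ double-half-power (e (suc i)) (1≤e[1+i] i) ⟩
    2 ^ e (suc i) ∎
    where
    open ℕₚ.≤-Reasoning
    P = 2 ^ (e (suc i) ∸ 1)

  module _ (e0≡0 : e 0 ≡ 0) where

    S-odd : ∀ i → S i ≡ 2 * K i + 1
    S-odd zero rewrite e0≡0 = refl
    S-odd (suc i) = begin
      S i + 2 ^ e (suc i)                   ≡⟨ cong₂ _+_ (S-odd i) (sym (double-half-power (e (suc i)) (1≤e[1+i] i))) ⟩
      2 * K i + 1 + 2 * 2 ^ (e (suc i) ∸ 1) ≡⟨ solve 2 (λ k p → con 2 :* k :+ con 1 :+ con 2 :* p
                                                              := con 2 :* (k :+ p) :+ con 1) refl (K i) _ ⟩
      2 * K (suc i) + 1                     ∎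
      where
      open ≡-Reasoning
      open ℕSolver.+-*-Solver

    S-step : ∀ i → S (suc i) ≡ 2 ^ e (suc i) + 2 * K i + 1
    S-step i = begin
      S i + 2 ^ e (suc i)           ≡⟨ cong (_+ 2 ^ e (suc i)) (S-odd i) ⟩
      2 * K i + 1 + 2 ^ e (suc i)   ≡⟨ solve 2 (λ k p → con 2 :* k :+ con 1 :+ p := p :+ con 2 :* k :+ con 1) refl (K i) _ ⟩
      2 ^ e (suc i) + 2 * K i + 1   ∎
      where
      open ≡-Reasoning
      open ℕSolver.+-*-Solver

DifferenceBound : Set
DifferenceBound = ∀ (E k : ℕ) → 1 ≤ E → k < 2 ^ (E ∸ 1) →
  ν≥ (f (2 ^ E + 2 * k + 1) -ℚ f (2 * k + 1))
     ((+ E - + (2 * lg (k + 3))) +ℤ + (2 * νℕ (k + 1)))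

-- One consecutive difference of f along the partial sums: the hypothesis
-- with E = e (i+1), k = K i gives valuation ≥ e (i+1) - 2 lg (K i + 3),
-- and lg (K i + 3) ≤ e i + 2.
consecutive-estimate : DifferenceBound → ∀ (e : ℕ → ℕ) (e0≡0 : e 0 ≡ 0) (increasing : ∀ i → e i < e (suc i)) →
  let open PartialSums e increasing in
  ∀ M i → (M + 4) + 2 * e i ≤ e (suc i) → ν≥ (f (S (suc i)) -ℚ f (S i)) (+ M)
consecutive-estimate bound e e0≡0 increasing M i growth =
  ν≥-from-bound _ M E L (2 * νℕ (K i + 1)) M+L≤E
    (subst (λ q → ν≥ q ((+ E - + L) +ℤ + (2 * νℕ (K i + 1)))) (sym same-difference) (bound E (K i) (1≤e[1+i] i) K<2^[E-1]))
  where
  open PartialSums e increasing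
  E = e (suc i)
  L = 2 * lg (K i + 3)
  K<2^[E-1] : K i < 2 ^ (E ∸ 1)
  K<2^[E-1] = ℕₚ.<-≤-trans (K-bound i) (ℕₚ.^-monoʳ-≤ 2 (ℕₚ.<⇒≤pred (increasing i)))
  M+L≤E : M + L ≤ E
  M+L≤E = begin
    M + 2 * lg (K i + 3) ≤⟨ ℕₚ.+-monoʳ-≤ M (ℕₚ.*-monoʳ-≤ 2 (lg-bound (K i) (e i) (K-bound i))) ⟩
    M + 2 * (e i + 2)    ≡⟨ solve 2 (λ m x → m :+ con 2 :* (x :+ con 2) := (m :+ con 4) :+ con 2 :* x) refl M (e i) ⟩
    (M + 4) + 2 * e i    ≤⟨ growth ⟩
    E                    ∎
    where
    open ℕₚ.≤-Reasoning
    open ℕSolver.+-*-Solver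
  same-difference : f (S (suc i)) -ℚ f (S i) ≡ f (2 ^ E + 2 * K i + 1) -ℚ f (2 * K i + 1)
  same-difference = cong₂ (λ a b → f a -ℚ f b) (S-step e0≡0 i) (S-odd e0≡0 i)

-- Given M, choose N with e (i+1) ≥ M + 4 + 2 e i for i ≥ N;
-- then for j, j' > e N both x_j and x_j' are partial sums S i, S i' with
-- i, i' ≥ N, whose f-values differ by valuation ≥ M.
proposition1p5 : (∀ (e k : ℕ) → 1 ≤ e → k < 2 ^ (e ∸ 1) →
    ν≥ (f (2 ^ e + 2 * k + 1) -ℚ f (2 * k + 1))
    ((+ e - + (2 * lg (k + 3))) +ℤ + (2 * νℕ (k + 1)))) →
    ∀ (e : ℕ → ℕ) → e 0 ≡ 0 → (∀ i → e i < e (suc i)) →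
    (∀ (M : ℕ) → ∃ λ (N : ℕ) → ∀ i → N ≤ i → M + 2 * e i ≤ e (suc i)) →
    TwoDefinable (xmod e)
proposition1p5 bound e e0≡0 increasing growth M with growth (M + 4)
... | N , growth≥N = suc (e N) , f-close
  where
  open PartialSums e increasing
  f-close : ∀ j j' → suc (e N) ≤ j → suc (e N) ≤ j' → ν≥ (f (xmod e j) -ℚ f (xmod e j')) (+ M)
  f-close j j' eN<j eN<j' with xmod-late N j eN<j | xmod-late N j' eN<j'
  ... | i , N≤i , xj≡Si | i' , N≤i' , xj'≡Si' rewrite xj≡Si | xj'≡Si' =
    ultrametric-Cauchy (λ n → f (S n)) M N
      (λ n N≤n → consecutive-estimate bound e e0≡0 increasing M n (growth≥N n N≤n))
      i i' N≤i N≤i'
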